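{- Let $G$ be a connected $P_5$-free chordal bipartite graph with bipartition $(A,B)$, let $(A_1,B_1)$ be a maximum biclique of $G$ with $A_1\subseteq A$, $B_1\subseteq B$, and let $A_2=A\setminus A_1=\{u_1,\dots,u_p\}$ and $B_2=B\setminus B_1=\{v_1,\dots,v_q\}$. If $d(u_1)\le d(u_2)\le\cdots\le d(u_p)$, then $N_G(u_1)\subseteq N_G(u_2)\subseteq\cdots\subseteq N_G(u_p)$. Further, if $d(v_1)\le d(v_2)\le\cdots\le d(v_q)$, then $N_G(v_1)\subseteq N_G(v_2)\subseteq\cdots\subseteq N_G(v_q)$.
   Context: Graphs are finite, simple and undirected. A bipartite graph is chordal bipartite if every cycle of length at least six has a chord. $G$ is $P_5$-free if it has no induced path on five vertices. $N_G(v)$ is the neighbourhood of $v$ and $d(v)=|N_G(v)|$. A biclique is a pair $(X,Y)$ with $X\subseteq A$, $Y\subseteq B$ such that every vertex of $X$ is adjacent to every vertex of $Y$; it is maximal if no vertex can be added to $X$ or to $Y$ keeping this property. Following the paper, a maximum biclique is a maximal biclique $(X,Y)$ for which $\bigl||X|-|Y|\bigr|$ is minimum. -}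

module Defs where

open import Data.Nat using (ℕ; zero; suc; _≤_; ∣_-_∣)
open import Data.Fin using (Fin; zero; suc; toℕ; inject₁; fromℕ)
open import Data.Fin.Subset using (Subset; _∈_; _∉_; _⊆_; ∣_∣)
open import Data.Vec using (tabulate)
open import Data.Bool using (Bool; true; false)
open import Data.Sum using (_⊎_; inj₁; inj₂)
open import Data.Product using (_×_; ∃; ∃₂; _,_)
open import Data.Empty using (⊥)
open import Relation.Nullary using (¬_)
open import Relation.Binary.PropositionalEquality using (_≡_)
open import Relation.Binary.Construct.Closure.ReflexiveTransitive using (Star)
open import Function.Definitions using (Injective)

-- A finite simple bipartite graph with bipartition (A , B), A = Fin m, B = Fin n,
-- is given by its bipartite adjacency: adj a b ≡ true iff a and b are adjacent.
BipGraph : ℕ → ℕ → Set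
BipGraph m n = Fin m → Fin n → Bool

Vertex : ℕ → ℕ → Set
Vertex m n = Fin m ⊎ Fin n

E : ∀ {m n} → BipGraph m n → Vertex m n → Vertex m n → Set
E G (inj₁ a) (inj₂ b) = G a b ≡ true
E G (inj₂ b) (inj₁ a) = G a b ≡ true
E G (inj₁ _) (inj₁ _) = ⊥
E G (inj₂ _) (inj₂ _) = ⊥

Connected : ∀ {m n} → BipGraph m n → Set
Connected {m} {n} G = (u v : Vertex m n) → Star (E G) u v

Consecutive : ∀ {k} → Fin k → Fin k → Set
Consecutive i j = toℕ j ≡ suc (toℕ i) ⊎ toℕ i ≡ suc (toℕ j)

IsInducedP5 : ∀ {m n} → BipGraph m n → (Fin 5 → Vertex m n) → Set
IsInducedP5 G f =
  Injective _≡_ _≡_ f ×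
  ((i j : Fin 5) → (E G (f i) (f j) → Consecutive i j) × (Consecutive i j → E G (f i) (f j)))

P5Free : ∀ {m n} → BipGraph m n → Set
P5Free {m} {n} G = (f : Fin 5 → Vertex m n) → ¬ IsInducedP5 G f

IsCycle : ∀ {m n} → BipGraph m n → (k : ℕ) → (Fin (suc k) → Vertex m n) → Set
IsCycle G k f =
  Injective _≡_ _≡_ f ×
  ((i : Fin k) → E G (f (inject₁ i)) (f (suc i))) ×
  E G (f (fromℕ k)) (f zero)

CycAdjacent : (k : ℕ) → Fin (suc k) → Fin (suc k) → Set
CycAdjacent k i j =
  Consecutive i j ⊎ (toℕ i ≡ 0 × toℕ j ≡ k) ⊎ (toℕ i ≡ k × toℕ j ≡ 0)

HasChord : ∀ {m n} → BipGraph m n → (k : ℕ) → (Fin (suc k) → Vertex m n) → Set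
HasChord G k f = ∃₂ λ i j → ¬ CycAdjacent k i j × E G (f i) (f j)

ChordalBipartite : ∀ {m n} → BipGraph m n → Set
ChordalBipartite {m} {n} G =
  (k : ℕ) → 6 ≤ suc k → (f : Fin (suc k) → Vertex m n) → IsCycle G k f → HasChord G k f

IsBiclique : ∀ {m n} → BipGraph m n → Subset m → Subset n → Set
IsBiclique G X Y = ∀ a b → a ∈ X → b ∈ Y → G a b ≡ true

IsMaximalBiclique : ∀ {m n} → BipGraph m n → Subset m → Subset n → Set
IsMaximalBiclique G X Y =
  IsBiclique G X Y ×
  (∀ a → a ∉ X → ¬ (∀ b → b ∈ Y → G a b ≡ true)) ×
  (∀ b → b ∉ Y → ¬ (∀ a → a ∈ X → G a b ≡ true))

-- Maximum biclique (paper's sense): maximal, with | |X| - |Y| | minimum among maximal bicliques.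
IsMaximumBiclique : ∀ {m n} → BipGraph m n → Subset m → Subset n → Set
IsMaximumBiclique {m} {n} G X Y =
  IsMaximalBiclique G X Y ×
  ((X' : Subset m) (Y' : Subset n) → IsMaximalBiclique G X' Y' →
     ∣ ∣ X ∣ - ∣ Y ∣ ∣ ≤ ∣ ∣ X' ∣ - ∣ Y' ∣ ∣)

NA : ∀ {m n} → BipGraph m n → Fin m → Subset n
NA G a = tabulate (G a)

NB : ∀ {m n} → BipGraph m n → Fin n → Subset m
NB G b = tabulate (λ a → G a b)

degA : ∀ {m n} → BipGraph m n → Fin m → ℕ
degA G a = ∣ NA G a ∣

degB : ∀ {m n} → BipGraph m n → Fin n → ℕ
degB G b = ∣ NB G b ∣

EnumeratesComplement : ∀ {k} → Subset k → (p : ℕ) → (Fin p → Fin k) → Set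
EnumeratesComplement {k} S p u =
  Injective _≡_ _≡_ u × (∀ i → u i ∉ S) × (∀ (x : Fin k) → x ∉ S → ∃ λ i → u i ≡ x)

{-# OPTIONS --safe #-}
-- Two vertices u, w on the same side of a connected P5-free bipartite graph have nested
-- neighbourhoods: otherwise b ∈ N(u) ∖ N(w) and b′ ∈ N(w) ∖ N(u) span an induced 2K2,
-- and following a walk from u to w produces an induced P5. Nested neighbourhoods are ordered
-- by inclusion as their sizes are, since a proper subset is strictly smaller. Hence the
-- conclusion holds for any degree-ordered vertices of one side.
module Submission where

open import Defs
open import Data.Nat using (ℕ; _≤_)
open import Data.Fin using (Fin)
open import Data.Fin.Subset using (Subset; _⊆_)
open import Data.Product using (_×_)

open import Data.Nat using (s≤s)
import Data.Nat.Properties as ℕₚ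
open import Data.Bool using (Bool; true)
import Data.Bool.Properties as Bool
open import Data.Empty using (⊥; ⊥-elim)
open import Data.Fin using (zero; suc; toℕ; _<_)
open import Data.Fin.Properties using (_≟_; all?; <-cmp)
open import Data.Fin.Subset using (_∈_; _∉_; ∣_∣)
open import Data.Fin.Subset.Properties using (_∈?_; p⊂q⇒∣p∣<∣q∣)
open import Data.Product using (_,_)
open import Data.Sum using (inj₁; inj₂; [_,_]′; swap)
open import Data.Unit using (⊤)
open import Data.Vec using ([]; _∷_; lookup; tabulate)
open import Data.Vec.Properties using (lookup∘tabulate; []=⇒lookup; lookup⇒[]=)
open import Function using (_∘_)
open import Relation.Binary using (Decidable; tri<; tri≈; tri>)
open import Relation.Binary.Construct.Closure.ReflexiveTransitive using (Star; ε; _◅_)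
open import Relation.Binary.PropositionalEquality using (_≡_; refl; sym; trans; subst)
open import Relation.Nullary using (¬_; yes; no; contradiction)
open import Relation.Nullary.Decidable using (toWitness; _⊎-dec_; _→-dec_)

pattern 0F = zero
pattern 1F = suc zero
pattern 2F = suc (suc zero)
pattern 3F = suc (suc (suc zero))
pattern 4F = suc (suc (suc (suc zero)))

Successor : ∀ {k} → Fin k → Fin k → Set
Successor i j = toℕ j ≡ ℕ.suc (toℕ i)

consecutive? : ∀ {k} → Decidable (Consecutive {k})
consecutive? i j = toℕ j ℕₚ.≟ ℕ.suc (toℕ i) ⊎-dec toℕ i ℕₚ.≟ ℕ.suc (toℕ j)

consecutive-separates : (i j : Fin 5) → (∀ k → Consecutive i k → Consecutive j k) →
  (∀ k → Consecutive j k → Consecutive i k) → i ≡ j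
consecutive-separates = toWitness {a? =
  all? λ i → all? λ j →
    all? (λ k → consecutive? i k →-dec consecutive? j k) →-dec
    all? (λ k → consecutive? j k →-dec consecutive? i k) →-dec
    i ≟ j} _

module _ {m n : ℕ} (G : BipGraph m n) where

  E-sym : ∀ {x y} → E G x y → E G y x
  E-sym {inj₁ _} {inj₂ _} e = e
  E-sym {inj₂ _} {inj₁ _} e = e

  E-irrefl : ∀ {x} → ¬ E G x x
  E-irrefl {inj₁ _} ()
  E-irrefl {inj₂ _} ()

  E? : Decidable (E G)
  E? (inj₁ a) (inj₂ b) = G a b Bool.≟ true
  E? (inj₂ b) (inj₁ a) = G a b Bool.≟ true
  E? (inj₁ _) (inj₁ _) = no λ ()
  E? (inj₂ _) (inj₂ _) = no λ ()

  SameSide : Vertex m n → Vertex m n → Set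
  SameSide (inj₁ _) (inj₁ _) = ⊤
  SameSide (inj₂ _) (inj₂ _) = ⊤
  SameSide _        _        = ⊥

  sameSide-trans : ∀ {x y z} → SameSide x y → SameSide y z → SameSide x z
  sameSide-trans {inj₁ _} {inj₁ _} {inj₁ _} _ _ = _
  sameSide-trans {inj₂ _} {inj₂ _} {inj₂ _} _ _ = _

  E-E⇒sameSide : ∀ {x y z} → E G x y → E G y z → SameSide x z
  E-E⇒sameSide {inj₁ _} {inj₂ _} {inj₁ _} _ _ = _
  E-E⇒sameSide {inj₂ _} {inj₁ _} {inj₂ _} _ _ = _

  sameSide⇒¬E : ∀ {x y} → SameSide x y → ¬ E G x y
  sameSide⇒¬E {inj₁ _} {inj₁ _} _ ()
  sameSide⇒¬E {inj₂ _} {inj₂ _} _ ()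

  -- In a bipartite graph the only possible chords of a path on five vertices join its
  -- vertices at distance three.
  inducedP5 : (f : Fin 5 → Vertex m n) → (∀ i j → Successor i j → E G (f i) (f j)) →
    ¬ E G (f 0F) (f 3F) → ¬ E G (f 1F) (f 4F) → IsInducedP5 G f
  inducedP5 f step ¬e₀₃ ¬e₁₄ = f-injective , λ i j → edge⇒consecutive i j , consecutive⇒edge i j
    where
    consecutive⇒edge : ∀ i j → Consecutive i j → E G (f i) (f j)
    consecutive⇒edge i j = [ step i j , E-sym ∘ step j i ]′

    even-distance : ∀ {i j k} → Successor i j → Successor j k → SameSide (f i) (f k)
    even-distance {i} {j} {k} s t = E-E⇒sameSide (step i j s) (step j k t)

    ordered-edge⇒consecutive : ∀ i j → i < j → E G (f i) (f j) → Consecutive i j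
    ordered-edge⇒consecutive 0F 1F _ _ = inj₁ refl
    ordered-edge⇒consecutive 1F 2F _ _ = inj₁ refl
    ordered-edge⇒consecutive 2F 3F _ _ = inj₁ refl
    ordered-edge⇒consecutive 3F 4F _ _ = inj₁ refl
    ordered-edge⇒consecutive 0F 2F _ e = ⊥-elim (sameSide⇒¬E (even-distance refl refl) e)
    ordered-edge⇒consecutive 1F 3F _ e = ⊥-elim (sameSide⇒¬E (even-distance refl refl) e)
    ordered-edge⇒consecutive 2F 4F _ e = ⊥-elim (sameSide⇒¬E (even-distance refl refl) e)
    ordered-edge⇒consecutive 0F 4F _ e =
      ⊥-elim (sameSide⇒¬E (sameSide-trans (even-distance refl refl) (even-distance refl refl)) e)
    ordered-edge⇒consecutive 0F 3F _ e = ⊥-elim (¬e₀₃ e)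
    ordered-edge⇒consecutive 1F 4F _ e = ⊥-elim (¬e₁₄ e)
    ordered-edge⇒consecutive (suc _) 1F (s≤s ()) _
    ordered-edge⇒consecutive (suc (suc _)) 2F (s≤s (s≤s ())) _
    ordered-edge⇒consecutive (suc (suc (suc _))) 3F (s≤s (s≤s (s≤s ()))) _
    ordered-edge⇒consecutive (suc (suc (suc (suc _)))) 4F (s≤s (s≤s (s≤s (s≤s ())))) _

    edge⇒consecutive : ∀ i j → E G (f i) (f j) → Consecutive i j
    edge⇒consecutive i j e with <-cmp i j
    ... | tri< i<j _ _ = ordered-edge⇒consecutive i j i<j e
    ... | tri≈ _ refl _ = ⊥-elim (E-irrefl e)
    ... | tri> _ _ j<i = swap (ordered-edge⇒consecutive j i j<i (E-sym e))

    neighbours-transfer : ∀ {i j} → f i ≡ f j → ∀ k → Consecutive i k → Consecutive j k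
    neighbours-transfer {i} {j} fi≡fj k c =
      edge⇒consecutive j k (subst (λ x → E G x (f k)) fi≡fj (consecutive⇒edge i k c))

    f-injective : ∀ {i j} → f i ≡ f j → i ≡ j
    f-injective {i} {j} eq =
      consecutive-separates i j (neighbours-transfer eq) (neighbours-transfer (sym eq))

  Induced2K2 : Vertex m n → Vertex m n → Vertex m n → Vertex m n → Set
  Induced2K2 x′ x y y′ =
    E G x′ x × E G y y′ × ¬ E G x y × ¬ E G x y′ × ¬ E G x′ y × ¬ E G x′ y′

  module _ (p5-free : P5Free G) where

    ¬P5-path : ∀ {v₀ v₁ v₂ v₃ v₄} → E G v₀ v₁ → E G v₁ v₂ → E G v₂ v₃ → E G v₃ v₄ →
      ¬ E G v₀ v₃ → ¬ E G v₁ v₄ → ⊥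
    ¬P5-path {v₀} {v₁} {v₂} {v₃} {v₄} e₀₁ e₁₂ e₂₃ e₃₄ ¬e₀₃ ¬e₁₄ =
      p5-free f (inducedP5 f step ¬e₀₃ ¬e₁₄)
      where
      f : Fin 5 → Vertex m n
      f = lookup (v₀ ∷ v₁ ∷ v₂ ∷ v₃ ∷ v₄ ∷ [])

      step : ∀ i j → Successor i j → E G (f i) (f j)
      step 0F 1F refl = e₀₁
      step 1F 2F refl = e₁₂
      step 2F 3F refl = e₂₃
      step 3F 4F refl = e₃₄

    -- The first vertex z of the walk adjacent to y or y′ closes a P5 x′ x z y y′ (or x′ x z y′ y);
    -- if there is none, x z y y′ is again an induced 2K2 and the walk is one step shorter.
    induced2K2⇒¬walk : ∀ {x′ x y y′} → Induced2K2 x′ x y y′ → ¬ Star (E G) x y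
    induced2K2⇒¬walk (e , _ , _ , _ , ¬x′y , _) ε = ¬x′y e
    induced2K2⇒¬walk {x′} {x} {y} {y′} (x′x , yy′ , ¬xy , ¬xy′ , ¬x′y , ¬x′y′) (_◅_ {j = z} xz walk)
      with E? z y | E? z y′
    ... | yes zy | _      = ¬P5-path x′x xz zy yy′ ¬x′y ¬xy′
    ... | no _   | yes zy′ = ¬P5-path x′x xz zy′ (E-sym yy′) ¬x′y′ ¬xy
    ... | no ¬zy | no ¬zy′ = induced2K2⇒¬walk (xz , yy′ , ¬zy , ¬zy′ , ¬xy , ¬xy′) walk

∈-tabulate⁺ : ∀ {k} (f : Fin k → Bool) {x} → f x ≡ true → x ∈ tabulate f
∈-tabulate⁺ f {x} fx = lookup⇒[]= x (tabulate f) (trans (lookup∘tabulate f x) fx)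

∈-tabulate⁻ : ∀ {k} (f : Fin k → Bool) {x} → x ∈ tabulate f → f x ≡ true
∈-tabulate⁻ f {x} x∈ = trans (sym (lookup∘tabulate f x)) ([]=⇒lookup x∈)

Nested : ∀ {k} → Subset k → Subset k → Set
Nested p q = ∀ {x y} → x ∈ p → x ∉ q → y ∈ q → y ∉ p → ⊥

nested∧∣∣≤⇒⊆ : ∀ {k} {p q : Subset k} → Nested p q → ∣ p ∣ ≤ ∣ q ∣ → p ⊆ q
nested∧∣∣≤⇒⊆ {p = p} {q} nested ∣p∣≤∣q∣ {x} x∈p with x ∈? q
... | yes x∈q = x∈q
... | no x∉q = contradiction ∣p∣≤∣q∣ (ℕₚ.<⇒≱ (p⊂q⇒∣p∣<∣q∣ (q⊆p , x , x∈p , x∉q)))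
  where
  q⊆p : q ⊆ p
  q⊆p {y} y∈q with y ∈? p
  ... | yes y∈p = y∈p
  ... | no y∉p = ⊥-elim (nested x∈p x∉q y∈q y∉p)

module _ {m n : ℕ} {G : BipGraph m n} (connected : Connected G) (p5-free : P5Free G) where

  NA-nested : ∀ u w → Nested (NA G u) (NA G w)
  NA-nested u w {b} {b′} b∈Nu b∉Nw b′∈Nw b′∉Nu =
    induced2K2⇒¬walk G p5-free {inj₂ b} {inj₁ u} {inj₁ w} {inj₂ b′}
      ( ∈-tabulate⁻ (G u) b∈Nu , ∈-tabulate⁻ (G w) b′∈Nw , (λ ())
      , b′∉Nu ∘ ∈-tabulate⁺ (G u) , b∉Nw ∘ ∈-tabulate⁺ (G w) , (λ ()))
      (connected (inj₁ u) (inj₁ w))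

  NB-nested : ∀ v w → Nested (NB G v) (NB G w)
  NB-nested v w {a} {a′} a∈Nv a∉Nw a′∈Nw a′∉Nv =
    induced2K2⇒¬walk G p5-free {inj₁ a} {inj₂ v} {inj₂ w} {inj₁ a′}
      ( ∈-tabulate⁻ (λ x → G x v) a∈Nv , ∈-tabulate⁻ (λ x → G x w) a′∈Nw , (λ ())
      , a′∉Nv ∘ ∈-tabulate⁺ (λ x → G x v) , a∉Nw ∘ ∈-tabulate⁺ (λ x → G x w) , (λ ()))
      (connected (inj₂ v) (inj₂ w))

theorem1 : ∀ {m n} (G : BipGraph m n) → Connected G → P5Free G → ChordalBipartite G →
    (A₁ : Subset m) (B₁ : Subset n) → IsMaximumBiclique G A₁ B₁ →
    ((p : ℕ) (u : Fin p → Fin m) → EnumeratesComplement A₁ p u →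
      (∀ i j → Data.Fin._≤_ i j → degA G (u i) ≤ degA G (u j)) →
      ∀ i j → Data.Fin._≤_ i j → NA G (u i) ⊆ NA G (u j)) ×
    ((q : ℕ) (v : Fin q → Fin n) → EnumeratesComplement B₁ q v →
      (∀ i j → Data.Fin._≤_ i j → degB G (v i) ≤ degB G (v j)) →
      ∀ i j → Data.Fin._≤_ i j → NB G (v i) ⊆ NB G (v j))
theorem1 G connected p5-free _ _ _ _ =
  (λ _ u _ deg≤ i j i≤j → nested∧∣∣≤⇒⊆ (NA-nested connected p5-free (u i) (u j)) (deg≤ i j i≤j)) ,
  (λ _ v _ deg≤ i j i≤j → nested∧∣∣≤⇒⊆ (NB-nested connected p5-free (v i) (v j)) (deg≤ i j i≤j))
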